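{- For integers $k,l$ with $0\le l\le k$, \[ \sum_{h=0}^{l}\sum_{j=0}^{k-l} i^{h+j}\binom{l}{h}\binom{k-l}{j}\mathbb{E}(h+j,h)=i^{k-1}\mathbb{E}(k,l)+\delta_{k,l}\,i+\delta_{l,0}, \] where $i=\sqrt{ -1}$ and $\delta$ is the Kronecker delta.
   Context: The Entringer numbers $\mathbb{E}(n,j)$ ($0\le j\le n$) are defined by $\mathbb{E}(0,0)=1$, $\mathbb{E}(n,0)=0$ for $n>0$, and $\mathbb{E}(n,j)=\mathbb{E}(n,j-1)+\mathbb{E}(n-1,n-j)$ for $n\ge1$, $1\le j\le n$. -}

module Defs where

open import Data.Nat using (ℕ; zero; suc; _∸_; _≡ᵇ_)
open import Data.Nat.Combinatorics using (_C_)
open import Data.Integer using (ℤ; +_; -[1+_]) renaming (_+_ to _+ℤ_; _*_ to _*ℤ_; -_ to -ℤ_; _-_ to _-ℤ_)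
open import Data.Bool using (if_then_else_)

-- Entringer numbers E(n,j), by the recursion of the paper:
-- E(0,0)=1, E(n,0)=0 for n>0, E(n,j)=E(n,j-1)+E(n-1,n-j) for 1≤j≤n.
-- (Values for j > n are junk and never used.)
𝔼 : ℕ → ℕ → ℕ
𝔼 zero zero = 1
𝔼 zero (suc j) = 0
𝔼 (suc n) zero = 0
𝔼 (suc n) (suc j) = 𝔼 (suc n) j + 𝔼 n (n ∸ j)
  where open Data.Nat using (_+_)

record Gauss : Set where
  constructor _+i_
  field
    re : ℤ
    im : ℤ
open Gauss public

infixl 6 _+G_
infixl 7 _*G_

_+G_ : Gauss → Gauss → Gauss
(a +i b) +G (c +i d) = (a +ℤ c) +i (b +ℤ d)

_*G_ : Gauss → Gauss → Gauss
(a +i b) *G (c +i d) = ((a *ℤ c) -ℤ (b *ℤ d)) +i ((a *ℤ d) +ℤ (b *ℤ c))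

ℕ→G : ℕ → Gauss
ℕ→G n = (+ n) +i (+ 0)

0G 1G iG : Gauss
0G = (+ 0) +i (+ 0)
1G = (+ 1) +i (+ 0)
iG = (+ 0) +i (+ 1)

iPow : ℕ → Gauss
iPow zero = 1G
iPow (suc m) = iG *G iPow m

conj : Gauss → Gauss
conj (a +i b) = a +i (-ℤ b)

-- i^m for integer m (i^{-m} = conj (i^m) since |i| = 1)
iPowℤ : ℤ → Gauss
iPowℤ (+ m) = iPow m
iPowℤ -[1+ m ] = conj (iPow (suc m))

ΣG : ℕ → (ℕ → Gauss) → Gauss
ΣG zero f = f 0
ΣG (suc n) f = ΣG n f +G f (suc n)

δ : ℕ → ℕ → Gauss
δ k l = if k ≡ᵇ l then 1G else 0G

-- Let T(a,b) be the double sum with l = a and k - l = b.  Pascal's rule in the outer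
-- binomial, the Entringer recursion E(n+1,h+1) = E(n+1,h) + E(n,n-h) and an exchange
-- of the two sums give T(a+1,b) = T(a,b+1) + i T(b,a), with T(0,b) = 1.  The
-- right-hand side obeys the same recursion (its Entringer part for the same reason,
-- its Kronecker-delta part because i² = -1) and the same boundary values, and the
-- recursion determines a function of (a,b) by induction on a + b.
module Submission where

open import Defs
open import Data.Nat using (ℕ; _≤_; _+_; _∸_)
open import Data.Nat.Combinatorics using (_C_)
open import Data.Integer using (+_; _-_)
open import Relation.Binary.PropositionalEquality using (_≡_)

open import Level using (0ℓ)
open import Data.Nat using (zero; suc)
open import Data.Nat.Properties using (+-suc; +-comm; suc-injective; m+n∸m≡n; m+[n∸m]≡n; n<1+n)
open import Data.Nat.Combinatorics using (nCk+nC[k+1]≡[n+1]C[k+1]; k>n⇒nCk≡0)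
open import Data.Integer using () renaming (_+_ to _+ℤ_; _*_ to _*ℤ_; -_ to -ℤ_)
import Data.Integer.Properties as ℤ
import Data.Integer.Tactic.RingSolver as ℤ-Solver
open import Data.Maybe using (just; nothing)
open import Data.Product using (_,_)
open import Algebra.Bundles using (CommutativeRing)
open import Tactic.RingSolver using (solve-∀)
open import Tactic.RingSolver.Core.AlmostCommutativeRing using (AlmostCommutativeRing; fromCommutativeRing)
open import Relation.Binary.PropositionalEquality using (refl; sym; trans; cong; cong₂; isEquivalence; module ≡-Reasoning)
open import Algebra.Structures {A = Gauss} _≡_ using (IsCommutativeRing)

open ≡-Reasoning

-G_ : Gauss → Gauss
-G (a +i b) = (-ℤ a) +i (-ℤ b)

+G-*G-isCommutativeRing : IsCommutativeRing _+G_ _*G_ -G_ 0G 1G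
+G-*G-isCommutativeRing = record
  { isRing = record
    { +-isAbelianGroup = record
      { isGroup = record
        { isMonoid = record
          { isSemigroup = record
            { isMagma = record { isEquivalence = isEquivalence ; ∙-cong = cong₂ _+G_ }
            ; assoc = λ { (a +i b) (c +i d) (e +i f) → cong₂ _+i_ (ℤ.+-assoc a c e) (ℤ.+-assoc b d f) }
            }
          ; identity = (λ { (a +i b) → cong₂ _+i_ (ℤ.+-identityˡ a) (ℤ.+-identityˡ b) })
                     , (λ { (a +i b) → cong₂ _+i_ (ℤ.+-identityʳ a) (ℤ.+-identityʳ b) })
          }
        ; inverse = (λ { (a +i b) → cong₂ _+i_ (ℤ.+-inverseˡ a) (ℤ.+-inverseˡ b) })
                  , (λ { (a +i b) → cong₂ _+i_ (ℤ.+-inverseʳ a) (ℤ.+-inverseʳ b) })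
        ; ⁻¹-cong = cong -G_
        }
      ; comm = λ { (a +i b) (c +i d) → cong₂ _+i_ (ℤ.+-comm a c) (ℤ.+-comm b d) }
      }
    ; *-cong = cong₂ _*G_
    ; *-assoc = λ { (a +i b) (c +i d) (e +i f) → cong₂ _+i_ (re-assoc a b c d e f) (im-assoc a b c d e f) }
    ; *-identity = (λ { (a +i b) → cong₂ _+i_ (re-identityˡ a b) (im-identityˡ a b) })
                 , (λ { (a +i b) → cong₂ _+i_ (re-identityʳ a b) (im-identityʳ a b) })
    ; distrib = (λ { (a +i b) (c +i d) (e +i f) → cong₂ _+i_ (re-distribˡ a b c d e f) (im-distribˡ a b c d e f) })
              , (λ { (a +i b) (c +i d) (e +i f) → cong₂ _+i_ (re-distribʳ a b c d e f) (im-distribʳ a b c d e f) })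
    }
  ; *-comm = λ { (a +i b) (c +i d) → cong₂ _+i_ (re-comm a b c d) (im-comm a b c d) }
  }
  where
  re-assoc : ∀ a b c d e f → (a *ℤ c - b *ℤ d) *ℤ e - (a *ℤ d +ℤ b *ℤ c) *ℤ f
                           ≡ a *ℤ (c *ℤ e - d *ℤ f) - b *ℤ (c *ℤ f +ℤ d *ℤ e)
  re-assoc = ℤ-Solver.solve-∀
  im-assoc : ∀ a b c d e f → (a *ℤ c - b *ℤ d) *ℤ f +ℤ (a *ℤ d +ℤ b *ℤ c) *ℤ e
                           ≡ a *ℤ (c *ℤ f +ℤ d *ℤ e) +ℤ b *ℤ (c *ℤ e - d *ℤ f)
  im-assoc = ℤ-Solver.solve-∀
  re-identityˡ : ∀ a b → + 1 *ℤ a - + 0 *ℤ b ≡ a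
  re-identityˡ = ℤ-Solver.solve-∀
  im-identityˡ : ∀ a b → + 1 *ℤ b +ℤ + 0 *ℤ a ≡ b
  im-identityˡ = ℤ-Solver.solve-∀
  re-identityʳ : ∀ a b → a *ℤ + 1 - b *ℤ + 0 ≡ a
  re-identityʳ = ℤ-Solver.solve-∀
  im-identityʳ : ∀ a b → a *ℤ + 0 +ℤ b *ℤ + 1 ≡ b
  im-identityʳ = ℤ-Solver.solve-∀
  re-distribˡ : ∀ a b c d e f → a *ℤ (c +ℤ e) - b *ℤ (d +ℤ f) ≡ (a *ℤ c - b *ℤ d) +ℤ (a *ℤ e - b *ℤ f)
  re-distribˡ = ℤ-Solver.solve-∀
  im-distribˡ : ∀ a b c d e f → a *ℤ (d +ℤ f) +ℤ b *ℤ (c +ℤ e) ≡ (a *ℤ d +ℤ b *ℤ c) +ℤ (a *ℤ f +ℤ b *ℤ e)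
  im-distribˡ = ℤ-Solver.solve-∀
  re-distribʳ : ∀ a b c d e f → (c +ℤ e) *ℤ a - (d +ℤ f) *ℤ b ≡ (c *ℤ a - d *ℤ b) +ℤ (e *ℤ a - f *ℤ b)
  re-distribʳ = ℤ-Solver.solve-∀
  im-distribʳ : ∀ a b c d e f → (c +ℤ e) *ℤ b +ℤ (d +ℤ f) *ℤ a ≡ (c *ℤ b +ℤ d *ℤ a) +ℤ (e *ℤ b +ℤ f *ℤ a)
  im-distribʳ = ℤ-Solver.solve-∀
  re-comm : ∀ a b c d → a *ℤ c - b *ℤ d ≡ c *ℤ a - d *ℤ b
  re-comm = ℤ-Solver.solve-∀
  im-comm : ∀ a b c d → a *ℤ d +ℤ b *ℤ c ≡ c *ℤ b +ℤ d *ℤ a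
  im-comm = ℤ-Solver.solve-∀

+G-*G-commutativeRing : CommutativeRing 0ℓ 0ℓ
+G-*G-commutativeRing = record { isCommutativeRing = +G-*G-isCommutativeRing }

module G = CommutativeRing +G-*G-commutativeRing

gaussAlmostCommutativeRing : AlmostCommutativeRing 0ℓ 0ℓ
gaussAlmostCommutativeRing = fromCommutativeRing +G-*G-commutativeRing
  λ { ((+ 0) +i (+ 0)) → just refl ; _ → nothing }

ΣG-cong : ∀ n {f g : ℕ → Gauss} → (∀ h → f h ≡ g h) → ΣG n f ≡ ΣG n g
ΣG-cong zero    f≡g = f≡g 0
ΣG-cong (suc n) f≡g = cong₂ _+G_ (ΣG-cong n f≡g) (f≡g (suc n))

ΣG-+ : ∀ n (f g : ℕ → Gauss) → ΣG n (λ h → f h +G g h) ≡ ΣG n f +G ΣG n g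
ΣG-+ zero    f g = refl
ΣG-+ (suc n) f g = begin
  ΣG n (λ h → f h +G g h) +G (f (suc n) +G g (suc n))
    ≡⟨ cong (_+G (f (suc n) +G g (suc n))) (ΣG-+ n f g) ⟩
  ΣG n f +G ΣG n g +G (f (suc n) +G g (suc n))
    ≡⟨ middleFour (ΣG n f) (ΣG n g) (f (suc n)) (g (suc n)) ⟩
  ΣG n f +G f (suc n) +G (ΣG n g +G g (suc n)) ∎
  where
  middleFour : ∀ w x y z → w +G x +G (y +G z) ≡ w +G y +G (x +G z)
  middleFour = solve-∀ gaussAlmostCommutativeRing

ΣG-*ˡ : ∀ n c (f : ℕ → Gauss) → ΣG n (λ h → c *G f h) ≡ c *G ΣG n f
ΣG-*ˡ zero    c f = refl
ΣG-*ˡ (suc n) c f = trans (cong (_+G c *G f (suc n)) (ΣG-*ˡ n c f))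
                          (sym (G.distribˡ c (ΣG n f) (f (suc n))))

ΣG-zero : ∀ n → ΣG n (λ _ → 0G) ≡ 0G
ΣG-zero zero    = refl
ΣG-zero (suc n) = cong (_+G 0G) (ΣG-zero n)

ΣG-suc : ∀ n (f : ℕ → Gauss) → ΣG (suc n) f ≡ f 0 +G ΣG n (λ h → f (suc h))
ΣG-suc zero    f = refl
ΣG-suc (suc n) f = trans (cong (_+G f (suc (suc n))) (ΣG-suc n f))
                         (G.+-assoc (f 0) (ΣG n (λ h → f (suc h))) (f (suc (suc n))))

ΣG-comm : ∀ m n (f : ℕ → ℕ → Gauss) →
          ΣG m (λ h → ΣG n (f h)) ≡ ΣG n (λ j → ΣG m (λ h → f h j))
ΣG-comm zero    n f = refl
ΣG-comm (suc m) n f = trans (cong (_+G ΣG n (f (suc m))) (ΣG-comm m n f))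
                            (sym (ΣG-+ n (λ j → ΣG m (λ h → f h j)) (f (suc m))))

binomial : ℕ → (ℕ → Gauss) → Gauss
binomial n φ = ΣG n (λ h → ℕ→G (n C h) *G φ h)

binomial-cong : ∀ n {φ ψ : ℕ → Gauss} → (∀ h → φ h ≡ ψ h) → binomial n φ ≡ binomial n ψ
binomial-cong n φ≡ψ = ΣG-cong n (λ h → cong (ℕ→G (n C h) *G_) (φ≡ψ h))

binomial-+ : ∀ n (φ ψ : ℕ → Gauss) → binomial n (λ h → φ h +G ψ h) ≡ binomial n φ +G binomial n ψ
binomial-+ n φ ψ = trans (ΣG-cong n (λ h → G.distribˡ (ℕ→G (n C h)) (φ h) (ψ h)))
                         (ΣG-+ n (λ h → ℕ→G (n C h) *G φ h) (λ h → ℕ→G (n C h) *G ψ h))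

*G-swap : ∀ x y z → x *G (y *G z) ≡ y *G (x *G z)
*G-swap = solve-∀ gaussAlmostCommutativeRing

binomial-*ˡ : ∀ n c (φ : ℕ → Gauss) → binomial n (λ h → c *G φ h) ≡ c *G binomial n φ
binomial-*ˡ n c φ = trans (ΣG-cong n (λ h → *G-swap (ℕ→G (n C h)) c (φ h)))
                          (ΣG-*ˡ n c (λ h → ℕ→G (n C h) *G φ h))

binomial-comm : ∀ m n (f : ℕ → ℕ → Gauss) →
                binomial m (λ h → binomial n (f h)) ≡ binomial n (λ j → binomial m (λ h → f h j))
binomial-comm m n f = begin
  binomial m (λ h → binomial n (f h))
    ≡⟨ ΣG-cong m (λ h → sym (ΣG-*ˡ n (ℕ→G (m C h)) (λ j → ℕ→G (n C j) *G f h j))) ⟩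
  ΣG m (λ h → ΣG n (λ j → ℕ→G (m C h) *G (ℕ→G (n C j) *G f h j)))
    ≡⟨ ΣG-comm m n _ ⟩
  ΣG n (λ j → ΣG m (λ h → ℕ→G (m C h) *G (ℕ→G (n C j) *G f h j)))
    ≡⟨ ΣG-cong n (λ j → ΣG-cong m (λ h → *G-swap (ℕ→G (m C h)) (ℕ→G (n C j)) (f h j))) ⟩
  ΣG n (λ j → ΣG m (λ h → ℕ→G (n C j) *G (ℕ→G (m C h) *G f h j)))
    ≡⟨ ΣG-cong n (λ j → ΣG-*ˡ m (ℕ→G (n C j)) (λ h → ℕ→G (m C h) *G f h j)) ⟩
  binomial n (λ j → binomial m (λ h → f h j)) ∎

binomial-extend : ∀ n (φ : ℕ → Gauss) → ΣG (suc n) (λ h → ℕ→G (n C h) *G φ h) ≡ binomial n φ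
binomial-extend n φ = begin
  binomial n φ +G ℕ→G (n C suc n) *G φ (suc n)
    ≡⟨ cong (λ m → binomial n φ +G ℕ→G m *G φ (suc n)) (k>n⇒nCk≡0 (n<1+n n)) ⟩
  binomial n φ +G 0G *G φ (suc n)
    ≡⟨ cong (binomial n φ +G_) (G.zeroˡ (φ (suc n))) ⟩
  binomial n φ +G 0G
    ≡⟨ G.+-identityʳ (binomial n φ) ⟩
  binomial n φ ∎

binomial-suc : ∀ n (φ : ℕ → Gauss) → binomial (suc n) φ ≡ binomial n φ +G binomial n (λ h → φ (suc h))
binomial-suc n φ = begin
  binomial (suc n) φ
    ≡⟨ ΣG-suc n _ ⟩
  φ₀ +G ΣG n (λ h → ℕ→G (suc n C suc h) *G φ (suc h))
    ≡⟨ cong (φ₀ +G_) (ΣG-cong n pascal) ⟩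
  φ₀ +G ΣG n (λ h → ℕ→G (n C suc h) *G φ (suc h) +G ℕ→G (n C h) *G φ (suc h))
    ≡⟨ cong (φ₀ +G_) (ΣG-+ n _ _) ⟩
  φ₀ +G (ΣG n (λ h → ℕ→G (n C suc h) *G φ (suc h)) +G binomial n (λ h → φ (suc h)))
    ≡⟨ sym (G.+-assoc φ₀ _ _) ⟩
  φ₀ +G ΣG n (λ h → ℕ→G (n C suc h) *G φ (suc h)) +G binomial n (λ h → φ (suc h))
    ≡⟨ cong (_+G binomial n (λ h → φ (suc h))) (sym (ΣG-suc n (λ h → ℕ→G (n C h) *G φ h))) ⟩
  ΣG (suc n) (λ h → ℕ→G (n C h) *G φ h) +G binomial n (λ h → φ (suc h))
    ≡⟨ cong (_+G binomial n (λ h → φ (suc h))) (binomial-extend n φ) ⟩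
  binomial n φ +G binomial n (λ h → φ (suc h)) ∎
  where
  φ₀ : Gauss
  φ₀ = ℕ→G (n C 0) *G φ 0
  pascal : ∀ h → ℕ→G (suc n C suc h) *G φ (suc h)
               ≡ ℕ→G (n C suc h) *G φ (suc h) +G ℕ→G (n C h) *G φ (suc h)
  pascal h = begin
    ℕ→G (suc n C suc h) *G φ (suc h)
      ≡⟨ cong (λ m → ℕ→G m *G φ (suc h)) (sym (nCk+nC[k+1]≡[n+1]C[k+1] n h)) ⟩
    (ℕ→G (n C h) +G ℕ→G (n C suc h)) *G φ (suc h)
      ≡⟨ cong (_*G φ (suc h)) (G.+-comm (ℕ→G (n C h)) (ℕ→G (n C suc h))) ⟩
    (ℕ→G (n C suc h) +G ℕ→G (n C h)) *G φ (suc h)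
      ≡⟨ G.distribʳ (φ (suc h)) (ℕ→G (n C suc h)) (ℕ→G (n C h)) ⟩
    ℕ→G (n C suc h) *G φ (suc h) +G ℕ→G (n C h) *G φ (suc h) ∎

binomial-supported-at-0 : ∀ n (φ : ℕ → Gauss) → (∀ h → φ (suc h) ≡ 0G) → binomial n φ ≡ φ 0
binomial-supported-at-0 zero    φ φ≡0 = G.*-identityˡ (φ 0)
binomial-supported-at-0 (suc n) φ φ≡0 = begin
  binomial (suc n) φ
    ≡⟨ binomial-suc n φ ⟩
  binomial n φ +G binomial n (λ h → φ (suc h))
    ≡⟨ cong₂ _+G_ (binomial-supported-at-0 n φ φ≡0) (binomial-cong n φ≡0) ⟩
  φ 0 +G binomial n (λ _ → 0G)
    ≡⟨ cong (φ 0 +G_) (trans (ΣG-cong n (λ h → G.zeroʳ (ℕ→G (n C h)))) (ΣG-zero n)) ⟩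
  φ 0 +G 0G
    ≡⟨ G.+-identityʳ (φ 0) ⟩
  φ 0 ∎

binomial² : (ℕ → ℕ → Gauss) → ℕ → ℕ → Gauss
binomial² f a b = binomial a (λ h → binomial b (f h))

-- For c = 1 and F a b = E(a+b, a) this is the Entringer recursion itself.
EntringerRecurrence : Gauss → (ℕ → ℕ → Gauss) → Set
EntringerRecurrence c F = ∀ a b → F (suc a) b ≡ F a (suc b) +G c *G F b a

entringerRecurrence-unique : ∀ {c} {F G : ℕ → ℕ → Gauss} →
  EntringerRecurrence c F → EntringerRecurrence c G → (∀ b → F 0 b ≡ G 0 b) →
  ∀ a b → F a b ≡ G a b
entringerRecurrence-unique {c} {F} {G} recF recG base a b = go (a + b) a b refl
  where
  go : ∀ n a b → a + b ≡ n → F a b ≡ G a b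
  go n       zero    b _  = base b
  go (suc n) (suc a) b eq = begin
    F (suc a) b                 ≡⟨ recF a b ⟩
    F a (suc b) +G c *G F b a   ≡⟨ cong₂ (λ x y → x +G c *G y) (go (suc n) a (suc b) (trans (+-suc a b) eq))
                                                                (go n b a (suc-injective (trans (cong suc (+-comm b a)) eq))) ⟩
    G a (suc b) +G c *G G b a   ≡⟨ sym (recG a b) ⟩
    G (suc a) b ∎

entringerRecurrence-+ : ∀ {c} {F G : ℕ → ℕ → Gauss} →
  EntringerRecurrence c F → EntringerRecurrence c G → EntringerRecurrence c (λ a b → F a b +G G a b)
entringerRecurrence-+ {c} {F} {G} recF recG a b = begin
  F (suc a) b +G G (suc a) b
    ≡⟨ cong₂ _+G_ (recF a b) (recG a b) ⟩
  F a (suc b) +G c *G F b a +G (G a (suc b) +G c *G G b a)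
    ≡⟨ regroup (F a (suc b)) (F b a) (G a (suc b)) (G b a) c ⟩
  F a (suc b) +G G a (suc b) +G c *G (F b a +G G b a) ∎
  where
  regroup : ∀ x y z w c → x +G c *G y +G (z +G c *G w) ≡ x +G z +G c *G (y +G w)
  regroup = solve-∀ gaussAlmostCommutativeRing

binomial²-entringerRecurrence : ∀ {c} {f : ℕ → ℕ → Gauss} →
  EntringerRecurrence c f → EntringerRecurrence c (binomial² f)
binomial²-entringerRecurrence {c} {f} rec a b = begin
  binomial² f (suc a) b
    ≡⟨ binomial-suc a _ ⟩
  binomial² f a b +G binomial a (λ h → binomial b (f (suc h)))
    ≡⟨ cong (binomial² f a b +G_) (trans (binomial-cong a inner) (binomial-+ a _ _)) ⟩
  binomial² f a b +G (binomial a (λ h → binomial b (λ j → f h (suc j)))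
                      +G binomial a (λ h → c *G binomial b (λ j → f j h)))
    ≡⟨ sym (G.+-assoc (binomial² f a b) _ _) ⟩
  binomial² f a b +G binomial a (λ h → binomial b (λ j → f h (suc j)))
                  +G binomial a (λ h → c *G binomial b (λ j → f j h))
    ≡⟨ cong₂ _+G_ (sym (trans (binomial-cong a (λ h → binomial-suc b (f h))) (binomial-+ a _ _)))
                  (binomial-*ˡ a c _) ⟩
  binomial² f a (suc b) +G c *G binomial a (λ h → binomial b (λ j → f j h))
    ≡⟨ cong (λ x → binomial² f a (suc b) +G c *G x) (binomial-comm a b (λ h j → f j h)) ⟩
  binomial² f a (suc b) +G c *G binomial² f b a ∎
  where
  inner : ∀ h → binomial b (f (suc h)) ≡ binomial b (λ j → f h (suc j)) +G c *G binomial b (λ j → f j h)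
  inner h = begin
    binomial b (f (suc h))
      ≡⟨ binomial-cong b (rec h) ⟩
    binomial b (λ j → f h (suc j) +G c *G f j h)
      ≡⟨ binomial-+ b _ _ ⟩
    binomial b (λ j → f h (suc j)) +G binomial b (λ j → c *G f j h)
      ≡⟨ cong (binomial b (λ j → f h (suc j)) +G_) (binomial-*ˡ b c _) ⟩
    binomial b (λ j → f h (suc j)) +G c *G binomial b (λ j → f j h) ∎

weightedEntringer : (ℕ → Gauss) → ℕ → ℕ → Gauss
weightedEntringer w a b = w (a + b) *G ℕ→G (𝔼 (a + b) a)

weightedEntringer-entringerRecurrence : ∀ c (w : ℕ → Gauss) → (∀ n → w (suc n) ≡ c *G w n) →
  EntringerRecurrence c (weightedEntringer w)
weightedEntringer-entringerRecurrence c w w-suc a b = begin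
  w (suc (a + b)) *G (ℕ→G (𝔼 (suc (a + b)) a) +G ℕ→G (𝔼 (a + b) (a + b ∸ a)))
    ≡⟨ G.distribˡ (w (suc (a + b))) _ _ ⟩
  w (suc (a + b)) *G ℕ→G (𝔼 (suc (a + b)) a) +G w (suc (a + b)) *G ℕ→G (𝔼 (a + b) (a + b ∸ a))
    ≡⟨ cong₂ _+G_ (cong (λ n → w n *G ℕ→G (𝔼 n a)) (sym (+-suc a b))) reflected ⟩
  weightedEntringer w a (suc b) +G c *G weightedEntringer w b a ∎
  where
  reflected : w (suc (a + b)) *G ℕ→G (𝔼 (a + b) (a + b ∸ a)) ≡ c *G weightedEntringer w b a
  reflected = begin
    w (suc (a + b)) *G ℕ→G (𝔼 (a + b) (a + b ∸ a))
      ≡⟨ cong₂ (λ x m → x *G ℕ→G (𝔼 (a + b) m)) (w-suc (a + b)) (m+n∸m≡n a b) ⟩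
    c *G w (a + b) *G ℕ→G (𝔼 (a + b) b)
      ≡⟨ G.*-assoc c (w (a + b)) _ ⟩
    c *G (w (a + b) *G ℕ→G (𝔼 (a + b) b))
      ≡⟨ cong (λ n → c *G (w n *G ℕ→G (𝔼 n b))) (+-comm a b) ⟩
    c *G weightedEntringer w b a ∎

boundaryTerm : ℕ → ℕ → Gauss
boundaryTerm a b = δ b 0 *G iG +G δ a 0

boundaryTerm-entringerRecurrence : EntringerRecurrence iG boundaryTerm
boundaryTerm-entringerRecurrence zero    zero    = refl
boundaryTerm-entringerRecurrence zero    (suc b) = refl
boundaryTerm-entringerRecurrence (suc a) zero    = refl
boundaryTerm-entringerRecurrence (suc a) (suc b) = refl

iPowℤ-pred : ℕ → Gauss
iPowℤ-pred n = iPowℤ (+ n - + 1)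

iPowℤ-pred-suc : ∀ n → iPowℤ-pred (suc n) ≡ iG *G iPowℤ-pred n
iPowℤ-pred-suc zero    = refl
iPowℤ-pred-suc (suc n) = refl

closedForm : ℕ → ℕ → Gauss
closedForm a b = weightedEntringer iPowℤ-pred a b +G boundaryTerm a b

closedForm-entringerRecurrence : EntringerRecurrence iG closedForm
closedForm-entringerRecurrence = entringerRecurrence-+ {c = iG} {F = weightedEntringer iPowℤ-pred} {G = boundaryTerm}
  (weightedEntringer-entringerRecurrence iG iPowℤ-pred iPowℤ-pred-suc)
  boundaryTerm-entringerRecurrence

closedForm-zero : ∀ b → closedForm 0 b ≡ 1G
closedForm-zero zero    = refl
closedForm-zero (suc b) = cong (_+G 1G) (G.zeroʳ (iPowℤ-pred (suc b)))

binomial²-entringer-zero : ∀ b → binomial² (weightedEntringer iPow) 0 b ≡ 1G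
binomial²-entringer-zero b = trans (G.*-identityˡ _)
  (binomial-supported-at-0 b (weightedEntringer iPow 0) (λ j → G.zeroʳ (iPow (suc j))))

binomial²-entringer≡closedForm : ∀ a b → binomial² (weightedEntringer iPow) a b ≡ closedForm a b
binomial²-entringer≡closedForm = entringerRecurrence-unique {c = iG} {F = binomial² (weightedEntringer iPow)} {G = closedForm}
  (binomial²-entringerRecurrence {c = iG} {f = weightedEntringer iPow} (weightedEntringer-entringerRecurrence iG iPow (λ _ → refl)))
  closedForm-entringerRecurrence
  (λ b → trans (binomial²-entringer-zero b) (sym (closedForm-zero b)))

doubleSum≡binomial² : ∀ l b →
  ΣG l (λ h → ΣG b (λ j → iPow (h + j) *G ℕ→G (l C h) *G ℕ→G (b C j) *G ℕ→G (𝔼 (h + j) h)))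
  ≡ binomial² (weightedEntringer iPow) l b
doubleSum≡binomial² l b = ΣG-cong l λ h → trans
  (ΣG-cong b (λ j → reorder (iPow (h + j)) (ℕ→G (l C h)) (ℕ→G (b C j)) (ℕ→G (𝔼 (h + j) h))))
  (ΣG-*ˡ b (ℕ→G (l C h)) (λ j → ℕ→G (b C j) *G weightedEntringer iPow h j))
  where
  reorder : ∀ w x y e → w *G x *G y *G e ≡ x *G (y *G (w *G e))
  reorder = solve-∀ gaussAlmostCommutativeRing

δ-+ˡ : ∀ l b → δ (l + b) l ≡ δ b 0
δ-+ˡ zero    zero    = refl
δ-+ˡ zero    (suc b) = refl
δ-+ˡ (suc l) b       = δ-+ˡ l b

closedForm≡rhs : ∀ l b →
  closedForm l b ≡ iPowℤ (+ (l + b) - + 1) *G ℕ→G (𝔼 (l + b) l) +G δ (l + b) l *G iG +G δ l 0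
closedForm≡rhs l b = begin
  weightedEntringer iPowℤ-pred l b +G (δ b 0 *G iG +G δ l 0)
    ≡⟨ sym (G.+-assoc (weightedEntringer iPowℤ-pred l b) (δ b 0 *G iG) (δ l 0)) ⟩
  weightedEntringer iPowℤ-pred l b +G δ b 0 *G iG +G δ l 0
    ≡⟨ cong (λ d → weightedEntringer iPowℤ-pred l b +G d *G iG +G δ l 0) (sym (δ-+ˡ l b)) ⟩
  weightedEntringer iPowℤ-pred l b +G δ (l + b) l *G iG +G δ l 0 ∎

mainTheorem6 : (k l : ℕ) → l ≤ k →
    ΣG l (λ h → ΣG (k ∸ l) (λ j →
        iPow (h + j) *G ℕ→G (l C h) *G ℕ→G ((k ∸ l) C j) *G ℕ→G (𝔼 (h + j) h)))
    ≡ iPowℤ (+ k - + 1) *G ℕ→G (𝔼 k l) +G δ k l *G iG +G δ l 0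
mainTheorem6 k l l≤k = begin
  ΣG l (λ h → ΣG (k ∸ l) (λ j →
      iPow (h + j) *G ℕ→G (l C h) *G ℕ→G ((k ∸ l) C j) *G ℕ→G (𝔼 (h + j) h)))
    ≡⟨ doubleSum≡binomial² l (k ∸ l) ⟩
  binomial² (weightedEntringer iPow) l (k ∸ l)
    ≡⟨ binomial²-entringer≡closedForm l (k ∸ l) ⟩
  closedForm l (k ∸ l)
    ≡⟨ closedForm≡rhs l (k ∸ l) ⟩
  rhs (l + (k ∸ l))
    ≡⟨ cong rhs (m+[n∸m]≡n l≤k) ⟩
  rhs k ∎
  where
  rhs : ℕ → Gauss
  rhs n = iPowℤ (+ n - + 1) *G ℕ→G (𝔼 n l) +G δ n l *G iG +G δ l 0
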